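{- Let $k\ge 2$. Then, as formal power series in $t$ with coefficients in $\mathbb{Q}(p,q,r,x)$, $$\sum_{n\ge 0}\frac{t^n}{[n]_{p,q}!}\sum_{(\sigma,w)\in C_k\wr S_n} q^{\mathrm{inv}(\sigma)}p^{\mathrm{coinv}(\sigma)}r^{\|w\|}x^{\mathrm{sris}(\sigma,w)}=\frac{1-x}{1-x+\sum_{n\ge 1}\frac{p^{\binom{n}{2}}((x-1)t)^n}{[n]_{p,q}!}r^{\binom{n}{2}}\begin{bmatrix} k\\ n\end{bmatrix}_r}.$$
   Context: For $k\ge 2$, $n\ge 0$, the wreath product $C_k\wr S_n$ is identified with the set of pairs $(\sigma,w)$ with $\sigma=\sigma_1\cdots\sigma_n\in S_n$ and $w=w_1\cdots w_n\in\{0,1,\dots,k-1\}^n$ (for $n=0$ there is exactly one, empty, element). $\mathrm{inv}(\sigma)=|\{i<j:\sigma_i>\sigma_j\}|$, $\mathrm{coinv}(\sigma)=|\{i<j:\sigma_i<\sigma_j\}|$, $\|w\|=w_1+\cdots+w_n$. The strict rise statistic is $\mathrm{sris}(\sigma,w)=|\{i\in\{1,\dots,n-1\}:\sigma_i<\sigma_{i+1}\text{ and } w_i< w_{i+1}\}|$. $[n]_{p,q}=\frac{p^n-q^n}{p-q}=p^{n-1}+p^{n-2}q+\cdots+q^{n-1}$, $[n]_{p,q}!=[n]_{p,q}\cdots[1]_{p,q}$ (with $[0]_{p,q}!=1$); $[n]_r=1+r+\cdots+r^{n-1}$, $[n]_r!=[n]_r\cdots[1]_r$, and $\begin{bmatrix}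 a\\ b\end{bmatrix}_r=\frac{[a]_r!}{[b]_r![a-b]_r!}$ for $0\le b\le a$, and $0$ if $b>a$. -}

module Defs where

open import Data.Nat as ℕ using (ℕ; zero; suc; _<ᵇ_)
open import Data.Nat.Combinatorics using (_C_)
open import Data.Bool using (Bool; true; false; if_then_else_; _∧_)
open import Data.List using (List; []; _∷_; map; concatMap; filter; upTo; length; zip)
open import Data.Nat.ListAction using (sum)
open import Data.Product using (_×_; _,_)
open import Relation.Nullary using (yes; no; ¬_)
open import Relation.Nullary.Decidable using (⌊_⌋)
open import Relation.Binary.PropositionalEquality using (_≡_)
open import Data.List.Relation.Unary.Unique.DecPropositional ℕ._≟_ using (unique?)
open import Data.Rational as ℚ using (ℚ; 0ℚ; 1ℚ; _+_; _*_; _-_; _÷_; ≢-nonZero)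
open import Data.Rational.Properties using (_≟_)

pow : ℚ → ℕ → ℚ
pow a zero    = 1ℚ
pow a (suc n) = a * pow a n

-- Total division: a / b when b ≠ 0 (the theorem's hypotheses guarantee
-- that every denominator used is nonzero); value 0 otherwise.
div : ℚ → ℚ → ℚ
div a b with b ≟ 0ℚ
... | yes _ = 0ℚ
... | no b≢0 = _÷_ a b {{≢-nonZero b≢0}}

nat : ℕ → ℚ
nat n = ℚ.fromℚᵘ (Data.Rational.Unnormalised.Base.mkℚᵘ (Data.Integer.Base.+ n) 0)
  where import Data.Rational.Unnormalised.Base
        import Data.Integer.Base

Σ< : ℕ → (ℕ → ℚ) → ℚ
Σ< zero    f = 0ℚ
Σ< (suc n) f = Σ< n f + f n

pqInt : ℚ → ℚ → ℕ → ℚ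
pqInt p q n = Σ< n (λ i → pow p (n ℕ.∸ 1 ℕ.∸ i) * pow q i)

pqFact : ℚ → ℚ → ℕ → ℚ
pqFact p q zero    = 1ℚ
pqFact p q (suc n) = pqInt p q (suc n) * pqFact p q n

rInt : ℚ → ℕ → ℚ
rInt r n = Σ< n (pow r)

rFact : ℚ → ℕ → ℚ
rFact r zero    = 1ℚ
rFact r (suc n) = rInt r (suc n) * rFact r n

gbin : ℚ → ℕ → ℕ → ℚ
gbin r a b = if a <ᵇ b then 0ℚ
             else div (rFact r a) (rFact r b * rFact r (a ℕ.∸ b))

words : List ℕ → ℕ → List (List ℕ)
words A zero    = [] ∷ []
words A (suc n) = concatMap (λ a → map (a ∷_) (words A n)) A

perms : ℕ → List (List ℕ)
perms n = filter unique? (words (map suc (upTo n)) n)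

colours : ℕ → ℕ → List (List ℕ)
colours k n = words (upTo k) n

wreath : ℕ → ℕ → List (List ℕ × List ℕ)
wreath k n = concatMap (λ σ → map (σ ,_) (colours k n)) (perms n)

count : (ℕ → Bool) → List ℕ → ℕ
count P xs = length (filter (λ b → Data.Bool.T? (P b)) xs)
  where import Data.Bool

inv : List ℕ → ℕ
inv []      = 0
inv (a ∷ s) = count (λ b → b <ᵇ a) s ℕ.+ inv s

coinv : List ℕ → ℕ
coinv []      = 0
coinv (a ∷ s) = count (λ b → a <ᵇ b) s ℕ.+ coinv s

norm : List ℕ → ℕ
norm = sum

srisL : List (ℕ × ℕ) → ℕ
srisL []                              = 0
srisL (_ ∷ [])                        = 0
srisL ((s₁ , w₁) ∷ (s₂ , w₂) ∷ rest) =
  (if (s₁ <ᵇ s₂) ∧ (w₁ <ᵇ w₂) then 1 else 0) ℕ.+ srisL ((s₂ , w₂) ∷ rest)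

sris : List ℕ × List ℕ → ℕ
sris (σ , w) = srisL (zip σ w)

-- Formal power series in t over ℚ: coefficient sequences

Series : Set
Series = ℕ → ℚ

_⋆_ : Series → Series → Series
(f ⋆ g) n = Σ< (suc n) (λ j → f j * g (n ℕ.∸ j))

sumL : {A : Set} → (A → ℚ) → List A → ℚ
sumL f []       = 0ℚ
sumL f (a ∷ as) = f a + sumL f as

lhsSeries : ℕ → ℚ → ℚ → ℚ → ℚ → Series
lhsSeries k p q r x n =
  div (sumL (λ { (σ , w) → pow q (inv σ) * pow p (coinv σ) * pow r (norm w)
                            * pow x (sris (σ , w)) }) (wreath k n))
      (pqFact p q n)

denSeries : ℕ → ℚ → ℚ → ℚ → ℚ → Series
denSeries k p q r x zero    = 1ℚ - x
denSeries k p q r x (suc m) =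
  div (pow p ((suc m) C 2) * pow (x - 1ℚ) (suc m)) (pqFact p q (suc m))
    * pow r ((suc m) C 2) * gbin r k (suc m)

numSeries : ℚ → Series
numSeries x zero    = 1ℚ - x
numSeries x (suc _) = 0ℚ

-- Clearing the denominator, the statement says that the coefficient of t^(N+1) of the left-hand
-- side times the denominator vanishes; this is a recurrence for A n = Σ q^inv p^coinv r^‖w‖ x^sris.
-- Reading (σ , w) from left to right and replacing each letter by its rank among the letters not
-- yet read turns A n into a sum over codes (i₁ , c₁) ⋯ (iₙ , cₙ) with iⱼ ≤ n − j, in which a strict
-- rise becomes iⱼ ≤ iⱼ₊₁ ∧ cⱼ < cⱼ₊₁. Writing x^[rise] = 1 + (x − 1)[rise] and expanding along the
-- initial run of rises, a run of m rises contributes (x − 1)^m times a weakly increasing sequence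
-- of ranks, summing to p^(m+1 choose 2) [N+1 choose m+1]_{p,q}, times a strictly increasing sequence
-- of colours, summing to r^(m+1 choose 2) [k choose m+1]_r, times A (N − m). Divided by
-- [N+1]_{p,q}!, this recurrence is the vanishing of that coefficient.

module Submission where

open import Defs
open import Data.Nat using (ℕ; _≤_)
open import Data.Rational using (ℚ; 0ℚ; 1ℚ)
open import Relation.Binary.PropositionalEquality using (_≡_; _≢_)

open import Data.Bool using (Bool; true; false; if_then_else_; _∧_)
open import Data.Empty using (⊥-elim)
open import Data.List using (List; []; _∷_; map; concatMap; filter; upTo; applyUpTo; length; _++_; zip)
open import Data.List.Membership.Propositional using (_∈_; _∉_)
open import Data.List.Membership.Propositional.Properties using (∈-filter⁻)
import Data.List.Properties as Listₚ
open import Data.List.Relation.Unary.All as All using (All; []; _∷_; all?)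
open import Data.List.Relation.Unary.AllPairs using (AllPairs; []; _∷_)
import Data.List.Relation.Unary.AllPairs.Properties as AllPairsₚ
open import Data.List.Relation.Unary.Any using (here; there)
open import Data.Maybe using (Maybe; just; nothing)
open import Data.Nat as ℕ using (zero; suc; _∸_; _<_; _<ᵇ_; _≤ᵇ_; z≤n; s≤s)
open import Data.List.Relation.Unary.Unique.DecPropositional ℕ._≟_ using (unique?)
open import Data.Nat.Combinatorics using (_C_; nCk+nC[k+1]≡[n+1]C[k+1]; nC1≡n)
import Data.Nat.Properties as ℕₚ
open import Data.Nat.Tactic.RingSolver using () renaming (solve-∀ to ℕ-solve-∀)
open import Data.Product using (_×_; _,_; proj₂)
open import Data.Rational using (_+_; _*_; _-_; 1/_; ≢-nonZero)
open import Data.Rational.Properties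
open import Data.Unit using (⊤; tt)
open import Function using (_∘_; id)
open import Level using (0ℓ)
open import Relation.Binary.Definitions using (tri<; tri≈; tri>)
open import Relation.Binary.PropositionalEquality using (refl; sym; trans; cong; cong₂; subst; module ≡-Reasoning)
open import Relation.Nullary using (does; ¬_; ¬?; yes; no)
open import Relation.Nullary.Decidable using (dec⇒maybe)
open import Relation.Nullary.Reflects using (ofʸ; ofⁿ; det)
open import Relation.Unary using (Pred; Decidable)
open import Tactic.RingSolver using (solve-∀)
import Tactic.RingSolver.Core.AlmostCommutativeRing as ACR

ℚ-ring : ACR.AlmostCommutativeRing 0ℓ 0ℓ
ℚ-ring = ACR.fromCommutativeRing +-*-commutativeRing (λ a → dec⇒maybe (0ℚ ≟ a))

+-medial : ∀ a b c d → a + b + (c + d) ≡ a + c + (b + d)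
+-medial = solve-∀ ℚ-ring

x*[y*z]≡y*[x*z] : ∀ a b c → a * (b * c) ≡ b * (a * c)
x*[y*z]≡y*[x*z] = solve-∀ ℚ-ring

module _ {A : Set} where

  sumL-cong : {f g : A → ℚ} → (∀ a → f a ≡ g a) → ∀ xs → sumL f xs ≡ sumL g xs
  sumL-cong f≗g []       = refl
  sumL-cong f≗g (a ∷ xs) = cong₂ _+_ (f≗g a) (sumL-cong f≗g xs)

  sumL-cong-All : {f g : A → ℚ} → ∀ xs → All (λ a → f a ≡ g a) xs → sumL f xs ≡ sumL g xs
  sumL-cong-All []       []         = refl
  sumL-cong-All (a ∷ xs) (fa≡ga ∷ e) = cong₂ _+_ fa≡ga (sumL-cong-All xs e)

  sumL-zero : (xs : List A) → sumL (λ _ → 0ℚ) xs ≡ 0ℚ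
  sumL-zero []       = refl
  sumL-zero (a ∷ xs) = trans (+-identityˡ (sumL (λ _ → 0ℚ) xs)) (sumL-zero xs)

  sumL-++ : ∀ (f : A → ℚ) xs ys → sumL f (xs ++ ys) ≡ sumL f xs + sumL f ys
  sumL-++ f []       ys = sym (+-identityˡ _)
  sumL-++ f (a ∷ xs) ys = trans (cong (f a +_) (sumL-++ f xs ys)) (sym (+-assoc (f a) _ _))

  sumL-distrib-+ : ∀ (f g : A → ℚ) xs → sumL (λ a → f a + g a) xs ≡ sumL f xs + sumL g xs
  sumL-distrib-+ f g []       = refl
  sumL-distrib-+ f g (a ∷ xs) =
    trans (cong (f a + g a +_) (sumL-distrib-+ f g xs)) (+-medial (f a) (g a) _ _)

  sumL-*ˡ : ∀ c (f : A → ℚ) xs → c * sumL f xs ≡ sumL (λ a → c * f a) xs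
  sumL-*ˡ c f []       = *-zeroʳ c
  sumL-*ˡ c f (a ∷ xs) = trans (*-distribˡ-+ c (f a) _) (cong (c * f a +_) (sumL-*ˡ c f xs))

  sumL-filter : ∀ {P : Pred A 0ℓ} (P? : Decidable P) (f : A → ℚ) xs →
    sumL f (filter P? xs) ≡ sumL (λ a → if does (P? a) then f a else 0ℚ) xs
  sumL-filter P? f []       = refl
  sumL-filter P? f (a ∷ xs) with does (P? a)
  ... | true  = cong (f a +_) (sumL-filter P? f xs)
  ... | false = trans (sumL-filter P? f xs) (sym (+-identityˡ _))

module _ {A B : Set} where

  sumL-map : ∀ (f : B → ℚ) (g : A → B) xs → sumL f (map g xs) ≡ sumL (f ∘ g) xs
  sumL-map f g []       = refl
  sumL-map f g (a ∷ xs) = cong (f (g a) +_) (sumL-map f g xs)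

  sumL-concatMap : ∀ (f : B → ℚ) (g : A → List B) xs →
    sumL f (concatMap g xs) ≡ sumL (λ a → sumL f (g a)) xs
  sumL-concatMap f g []       = refl
  sumL-concatMap f g (a ∷ xs) =
    trans (sumL-++ f (g a) (concatMap g xs)) (cong (sumL f (g a) +_) (sumL-concatMap f g xs))

  sumL-comm : ∀ (f : A → B → ℚ) xs ys →
    sumL (λ a → sumL (f a) ys) xs ≡ sumL (λ b → sumL (λ a → f a b) xs) ys
  sumL-comm f []       ys = sym (sumL-zero ys)
  sumL-comm f (a ∷ xs) ys =
    trans (cong (sumL (f a) ys +_) (sumL-comm f xs ys)) (sym (sumL-distrib-+ (f a) (λ b → sumL (λ a′ → f a′ b) xs) ys))

Σ<-cong : ∀ n {f g : ℕ → ℚ} → (∀ i → i < n → f i ≡ g i) → Σ< n f ≡ Σ< n g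
Σ<-cong zero    f≗g = refl
Σ<-cong (suc n) f≗g = cong₂ _+_ (Σ<-cong n (λ i i<n → f≗g i (ℕₚ.m<n⇒m<1+n i<n))) (f≗g n ℕₚ.≤-refl)

Σ<-cong′ : ∀ n {f g : ℕ → ℚ} → (∀ i → f i ≡ g i) → Σ< n f ≡ Σ< n g
Σ<-cong′ n f≗g = Σ<-cong n (λ i _ → f≗g i)

Σ<-zero : ∀ n → Σ< n (λ _ → 0ℚ) ≡ 0ℚ
Σ<-zero zero    = refl
Σ<-zero (suc n) = trans (+-identityʳ _) (Σ<-zero n)

Σ<-distrib-+ : ∀ n (f g : ℕ → ℚ) → Σ< n (λ i → f i + g i) ≡ Σ< n f + Σ< n g
Σ<-distrib-+ zero    f g = refl
Σ<-distrib-+ (suc n) f g =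
  trans (cong (_+ (f n + g n)) (Σ<-distrib-+ n f g)) (+-medial (Σ< n f) (Σ< n g) (f n) (g n))

Σ<-*ˡ : ∀ n c (f : ℕ → ℚ) → c * Σ< n f ≡ Σ< n (λ i → c * f i)
Σ<-*ˡ zero    c f = *-zeroʳ c
Σ<-*ˡ (suc n) c f = trans (*-distribˡ-+ c _ (f n)) (cong (_+ c * f n) (Σ<-*ˡ n c f))

Σ<-*ʳ : ∀ n c (f : ℕ → ℚ) → Σ< n f * c ≡ Σ< n (λ i → f i * c)
Σ<-*ʳ n c f = trans (*-comm _ c) (trans (Σ<-*ˡ n c f) (Σ<-cong′ n (λ i → *-comm c (f i))))

Σ<-head : ∀ n (f : ℕ → ℚ) → Σ< (suc n) f ≡ f 0 + Σ< n (f ∘ suc)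
Σ<-head zero    f = trans (+-identityˡ (f 0)) (sym (+-identityʳ (f 0)))
Σ<-head (suc n) f = trans (cong (_+ f (suc n)) (Σ<-head n f)) (+-assoc (f 0) _ (f (suc n)))

Σ<-+ : ∀ a b (f : ℕ → ℚ) → Σ< (a ℕ.+ b) f ≡ Σ< a f + Σ< b (λ j → f (a ℕ.+ j))
Σ<-+ a zero    f rewrite ℕₚ.+-identityʳ a = sym (+-identityʳ _)
Σ<-+ a (suc b) f rewrite ℕₚ.+-suc a b =
  trans (cong (_+ f (a ℕ.+ b)) (Σ<-+ a b f)) (+-assoc (Σ< a f) _ (f (a ℕ.+ b)))

Σ<-reverse : ∀ n (f : ℕ → ℚ) → Σ< n f ≡ Σ< n (λ i → f (n ∸ suc i))
Σ<-reverse zero    f = refl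
Σ<-reverse (suc n) f =
  trans (cong (_+ f n) (Σ<-reverse n f)) (trans (+-comm _ (f n)) (sym (Σ<-head n (λ i → f (n ∸ i)))))

Σ<-convolution : ∀ N (f g : ℕ → ℚ) → Σ< (suc N) (λ j → f j * g (suc N ∸ j)) ≡ Σ< (suc N) (λ m → f (N ∸ m) * g (suc m))
Σ<-convolution N f g =
  trans (Σ<-cong (suc N) (λ j j≤N → cong (λ i → f j * g i) (ℕₚ.+-∸-assoc 1 (ℕₚ.≤-pred j≤N))))
        (trans (Σ<-reverse (suc N) _)
               (Σ<-cong (suc N) (λ m m≤N → cong (λ i → f (N ∸ m) * g (suc i)) (ℕₚ.m∸[m∸n]≡n (ℕₚ.≤-pred m≤N)))))

Σ<-product : ∀ n m (f g : ℕ → ℚ) → Σ< n (λ i → Σ< m (λ j → f i * g j)) ≡ Σ< n f * Σ< m g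
Σ<-product n m f g = trans (Σ<-cong′ n (λ i → sym (Σ<-*ˡ m (f i) g))) (sym (Σ<-*ʳ n (Σ< m g) f))

sumL-applyUpTo : ∀ {A : Set} (f : A → ℚ) (g : ℕ → A) n → sumL f (applyUpTo g n) ≡ Σ< n (f ∘ g)
sumL-applyUpTo f g zero    = refl
sumL-applyUpTo f g (suc n) =
  trans (cong (f (g 0) +_) (sumL-applyUpTo f (g ∘ suc) n)) (sym (Σ<-head n (f ∘ g)))

≤ᵇ-true : ∀ {m n} → m ≤ n → (m ≤ᵇ n) ≡ true
≤ᵇ-true {m} {n} m≤n = det (ℕₚ.≤ᵇ-reflects-≤ m n) (ofʸ m≤n)

≤ᵇ-false : ∀ {m n} → ¬ m ≤ n → (m ≤ᵇ n) ≡ false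
≤ᵇ-false {m} {n} m≰n = det (ℕₚ.≤ᵇ-reflects-≤ m n) (ofⁿ m≰n)

<ᵇ-true : ∀ {m n} → m < n → (m <ᵇ n) ≡ true
<ᵇ-true {m} {n} m<n = det (ℕₚ.<ᵇ-reflects-< m n) (ofʸ m<n)

<ᵇ-false : ∀ {m n} → ¬ m < n → (m <ᵇ n) ≡ false
<ᵇ-false {m} {n} m≮n = det (ℕₚ.<ᵇ-reflects-< m n) (ofⁿ m≮n)

indicator : Bool → ℚ
indicator b = if b then 1ℚ else 0ℚ

indicator-∧ : ∀ a b → indicator (a ∧ b) ≡ indicator a * indicator b
indicator-∧ true  b = sym (*-identityˡ (indicator b))
indicator-∧ false b = sym (*-zeroˡ (indicator b))

Σ<-from : ∀ n s (f : ℕ → ℚ) → Σ< n (λ c → indicator (s ≤ᵇ c) * f c) ≡ Σ< (n ∸ s) (λ j → f (s ℕ.+ j))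
Σ<-from n s f with s ℕ.≤? n
... | yes s≤n = begin
  Σ< n (λ c → indicator (s ≤ᵇ c) * f c)
    ≡⟨ cong (λ n′ → Σ< n′ (λ c → indicator (s ≤ᵇ c) * f c)) (sym (ℕₚ.m+[n∸m]≡n s≤n)) ⟩
  Σ< (s ℕ.+ (n ∸ s)) (λ c → indicator (s ≤ᵇ c) * f c)
    ≡⟨ Σ<-+ s (n ∸ s) _ ⟩
  Σ< s (λ c → indicator (s ≤ᵇ c) * f c) + Σ< (n ∸ s) (λ j → indicator (s ≤ᵇ s ℕ.+ j) * f (s ℕ.+ j))
    ≡⟨ cong₂ _+_ (trans (Σ<-cong s below) (Σ<-zero s)) (Σ<-cong′ (n ∸ s) above) ⟩
  0ℚ + Σ< (n ∸ s) (λ j → f (s ℕ.+ j))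
    ≡⟨ +-identityˡ _ ⟩
  Σ< (n ∸ s) (λ j → f (s ℕ.+ j)) ∎
  where
  open ≡-Reasoning
  below : ∀ c → c < s → indicator (s ≤ᵇ c) * f c ≡ 0ℚ
  below c c<s rewrite ≤ᵇ-false (ℕₚ.<⇒≱ c<s) = *-zeroˡ (f c)
  above : ∀ j → indicator (s ≤ᵇ s ℕ.+ j) * f (s ℕ.+ j) ≡ f (s ℕ.+ j)
  above j rewrite ≤ᵇ-true (ℕₚ.m≤m+n s j) = *-identityˡ (f (s ℕ.+ j))
... | no s≰n rewrite ℕₚ.m≤n⇒m∸n≡0 (ℕₚ.<⇒≤ (ℕₚ.≰⇒> s≰n)) = trans (Σ<-cong n below) (Σ<-zero n)
  where
  below : ∀ c → c < n → indicator (s ≤ᵇ c) * f c ≡ 0ℚ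
  below c c<n rewrite ≤ᵇ-false (ℕₚ.<⇒≱ (ℕₚ.<-trans c<n (ℕₚ.≰⇒> s≰n))) = *-zeroˡ (f c)

Σ<² : ℕ → ℕ → (ℕ → ℕ → ℚ) → ℚ
Σ<² n m f = Σ< n (λ i → Σ< m (f i))

Σ<²-cong : ∀ n m {f g : ℕ → ℕ → ℚ} → (∀ i j → f i j ≡ g i j) → Σ<² n m f ≡ Σ<² n m g
Σ<²-cong n m f≗g = Σ<-cong′ n (λ i → Σ<-cong′ m (f≗g i))

Σ<²-distrib-+ : ∀ n m (f g : ℕ → ℕ → ℚ) → Σ<² n m (λ i j → f i j + g i j) ≡ Σ<² n m f + Σ<² n m g
Σ<²-distrib-+ n m f g = trans (Σ<-cong′ n (λ i → Σ<-distrib-+ m (f i) (g i))) (Σ<-distrib-+ n _ _)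

Σ<²-*ˡ : ∀ n m a (f : ℕ → ℕ → ℚ) → a * Σ<² n m f ≡ Σ<² n m (λ i j → a * f i j)
Σ<²-*ˡ n m a f = trans (Σ<-*ˡ n a _) (Σ<-cong′ n (λ i → Σ<-*ˡ m a (f i)))

Σ<²-comm : ∀ n m (f : ℕ → ℕ → ℚ) → Σ<² n m f ≡ Σ<² m n (λ j i → f i j)
Σ<²-comm zero    m f = sym (Σ<-zero m)
Σ<²-comm (suc n) m f = trans (cong (_+ Σ< m (f n)) (Σ<²-comm n m f)) (sym (Σ<-distrib-+ m _ (f n)))

Σ<²-comm-Σ< : ∀ n m l (f : ℕ → ℕ → ℕ → ℚ) → Σ<² n m (λ i j → Σ< l (f i j)) ≡ Σ< l (λ t → Σ<² n m (λ i j → f i j t))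
Σ<²-comm-Σ< n m l f = trans (Σ<-cong′ n (λ i → Σ<²-comm m l (f i))) (Σ<²-comm n l _)

-- Gaussian binomial coefficients

suc-C2 : ∀ m → suc m C 2 ≡ m ℕ.+ m C 2
suc-C2 m = trans (sym (nCk+nC[k+1]≡[n+1]C[k+1] m 1)) (cong (ℕ._+ m C 2) (nC1≡n m))

∸-suc-+ : ∀ n s j → n ∸ suc (s ℕ.+ j) ≡ n ∸ s ∸ suc j
∸-suc-+ n s j = trans (cong (n ∸_) (sym (ℕₚ.+-suc s j))) (sym (ℕₚ.∸-+-assoc n s (suc j)))

pow-+ : ∀ a m n → pow a (m ℕ.+ n) ≡ pow a m * pow a n
pow-+ a zero    n = sym (*-identityˡ _)
pow-+ a (suc m) n = trans (cong (a *_) (pow-+ a m n)) (sym (*-assoc a (pow a m) (pow a n)))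

pow-*-pow : ∀ a e₁ e₂ e₃ e₄ → e₁ ℕ.+ e₂ ≡ e₃ ℕ.+ e₄ → pow a e₁ * pow a e₂ ≡ pow a e₃ * pow a e₄
pow-*-pow a e₁ e₂ e₃ e₄ e = trans (sym (pow-+ a e₁ e₂)) (trans (cong (pow a) e) (pow-+ a e₃ e₄))

pow-1 : ∀ n → pow 1ℚ n ≡ 1ℚ
pow-1 zero    = refl
pow-1 (suc n) = trans (*-identityˡ _) (pow-1 n)

pow-1-* : ∀ n a → pow 1ℚ n * a ≡ a
pow-1-* n a = trans (cong (_* a) (pow-1 n)) (*-identityˡ a)

module _ (p q : ℚ) where

  pqInt-suc : ∀ n → pqInt p q (suc n) ≡ pow p n + q * pqInt p q n
  pqInt-suc n =
    trans (Σ<-head n _) (cong₂ _+_ (*-identityʳ (pow p n)) (trans (Σ<-cong′ n tail) (sym (Σ<-*ˡ n q _))))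
    where
    tail : ∀ i → pow p (n ∸ suc i) * (q * pow q i) ≡ q * (pow p (n ∸ 1 ∸ i) * pow q i)
    tail i rewrite ℕₚ.∸-+-assoc n 1 i = x*[y*z]≡y*[x*z] (pow p (n ∸ suc i)) q (pow q i)

  pqInt-+ : ∀ s t → pqInt p q (s ℕ.+ t) ≡ pow p t * pqInt p q s + pow q s * pqInt p q t
  pqInt-+ zero    t =
    sym (trans (cong (_+ 1ℚ * pqInt p q t) (*-zeroʳ (pow p t))) (trans (+-identityˡ _) (*-identityˡ _)))
  pqInt-+ (suc s) t = begin
    pqInt p q (suc (s ℕ.+ t))                          ≡⟨ pqInt-suc (s ℕ.+ t) ⟩
    pow p (s ℕ.+ t) + q * pqInt p q (s ℕ.+ t)          ≡⟨ cong₂ (λ u v → u + q * v) (pow-+ p s t) (pqInt-+ s t) ⟩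
    pow p s * pow p t + q * (pow p t * pqInt p q s + pow q s * pqInt p q t)
                                                      ≡⟨ regroup (pow p s) (pow p t) (pqInt p q s) (pqInt p q t) (pow q s) q ⟩
    pow p t * (pow p s + q * pqInt p q s) + q * pow q s * pqInt p q t
                                                      ≡⟨ cong (λ z → pow p t * z + q * pow q s * pqInt p q t) (sym (pqInt-suc s)) ⟩
    pow p t * pqInt p q (suc s) + q * pow q s * pqInt p q t ∎
    where
    open ≡-Reasoning
    regroup : ∀ ps pt i j qs q → ps * pt + q * (pt * i + qs * j) ≡ pt * (ps + q * i) + q * qs * j
    regroup = solve-∀ ℚ-ring

  pqBinom : ℕ → ℕ → ℚ
  pqBinom a       zero    = 1ℚ
  pqBinom zero    (suc m) = 0ℚ
  pqBinom (suc a) (suc m) = pow p (a ∸ m) * pqBinom a m + pow q (suc m) * pqBinom a (suc m)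

  a<m⇒pqBinom≡0 : ∀ a m → a < m → pqBinom a m ≡ 0ℚ
  a<m⇒pqBinom≡0 zero    (suc m) _ = refl
  a<m⇒pqBinom≡0 (suc a) (suc m) (s≤s a<m)
    rewrite a<m⇒pqBinom≡0 a m a<m | a<m⇒pqBinom≡0 a (suc m) (ℕₚ.m<n⇒m<1+n a<m) =
    cong₂ _+_ (*-zeroʳ (pow p (a ∸ m))) (*-zeroʳ (pow q (suc m)))

  mutual
    pqBinom-pqFact : ∀ b t → pqBinom (b ℕ.+ t) b * (pqFact p q b * pqFact p q t) ≡ pqFact p q (b ℕ.+ t)
    pqBinom-pqFact zero    t = trans (*-identityˡ (1ℚ * pqFact p q t)) (*-identityˡ (pqFact p q t))
    pqBinom-pqFact (suc b) t = begin
      (pow p (b ℕ.+ t ∸ b) * G b + pow q (suc b) * G (suc b)) * F!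
        ≡⟨ *-distribʳ-+ F! (pow p (b ℕ.+ t ∸ b) * G b) (pow q (suc b) * G (suc b)) ⟩
      pow p (b ℕ.+ t ∸ b) * G b * F! + pow q (suc b) * G (suc b) * F!
        ≡⟨ cong₂ _+_ low high ⟩
      pow p t * pqInt p q (suc b) * pqFact p q (b ℕ.+ t) + pow q (suc b) * pqInt p q t * pqFact p q (b ℕ.+ t)
        ≡⟨ sym (*-distribʳ-+ (pqFact p q (b ℕ.+ t)) (pow p t * pqInt p q (suc b)) (pow q (suc b) * pqInt p q t)) ⟩
      (pow p t * pqInt p q (suc b) + pow q (suc b) * pqInt p q t) * pqFact p q (b ℕ.+ t)
        ≡⟨ cong (_* pqFact p q (b ℕ.+ t)) (sym (pqInt-+ (suc b) t)) ⟩
      pqFact p q (suc b ℕ.+ t) ∎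
      where
      open ≡-Reasoning
      G : ℕ → ℚ
      G = pqBinom (b ℕ.+ t)
      F! : ℚ
      F! = pqFact p q (suc b) * pqFact p q t
      regroup : ∀ a g i f₁ f₂ → a * g * ((i * f₁) * f₂) ≡ a * i * (g * (f₁ * f₂))
      regroup = solve-∀ ℚ-ring
      low : pow p (b ℕ.+ t ∸ b) * G b * F! ≡ pow p t * pqInt p q (suc b) * pqFact p q (b ℕ.+ t)
      low rewrite ℕₚ.m+n∸m≡n b t =
        trans (regroup (pow p t) (G b) (pqInt p q (suc b)) (pqFact p q b) (pqFact p q t))
              (cong (pow p t * pqInt p q (suc b) *_) (pqBinom-pqFact b t))
      high : pow q (suc b) * G (suc b) * F! ≡ pow q (suc b) * pqInt p q t * pqFact p q (b ℕ.+ t)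
      high = trans (*-assoc (pow q (suc b)) _ _)
                   (trans (cong (pow q (suc b) *_) (pqBinom-suc-pqFact b t)) (sym (*-assoc (pow q (suc b)) _ _)))

    pqBinom-suc-pqFact : ∀ b t →
      pqBinom (b ℕ.+ t) (suc b) * (pqFact p q (suc b) * pqFact p q t) ≡ pqInt p q t * pqFact p q (b ℕ.+ t)
    pqBinom-suc-pqFact b zero rewrite ℕₚ.+-identityʳ b | a<m⇒pqBinom≡0 b (suc b) ℕₚ.≤-refl =
      trans (*-zeroˡ (pqFact p q (suc b) * 1ℚ)) (sym (*-zeroˡ (pqFact p q b)))
    pqBinom-suc-pqFact b (suc t) rewrite ℕₚ.+-suc b t =
      trans (regroup (pqBinom (suc b ℕ.+ t) (suc b)) (pqInt p q (suc t)) (pqFact p q (suc b)) (pqFact p q t))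
            (cong (pqInt p q (suc t) *_) (pqBinom-pqFact (suc b) t))
      where
      regroup : ∀ g i f₁ f₂ → g * (f₁ * (i * f₂)) ≡ i * (g * (f₁ * f₂))
      regroup = solve-∀ ℚ-ring

  pow-∸-pqBinom : ∀ a m → pow p m * (pow p (a ∸ m) * pqBinom a m) ≡ pow p a * pqBinom a m
  pow-∸-pqBinom a m with m ℕ.≤? a
  ... | yes m≤a = trans (sym (*-assoc (pow p m) _ _))
                        (cong (_* pqBinom a m) (trans (sym (pow-+ p m (a ∸ m))) (cong (pow p) (ℕₚ.m+[n∸m]≡n m≤a))))
  ... | no  m≰a rewrite a<m⇒pqBinom≡0 a m (ℕₚ.≰⇒> m≰a) =
    trans (cong (pow p m *_) (*-zeroʳ (pow p (a ∸ m)))) (trans (*-zeroʳ (pow p m)) (sym (*-zeroʳ (pow p a))))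

  pqBinom-suc-sum : ∀ a m →
    pow p m * pqBinom a (suc m) ≡ Σ< a (λ j → pow q (j ℕ.* suc m) * (pow p (a ∸ suc j) * pqBinom (a ∸ suc j) m))
  pqBinom-suc-sum zero    m = *-zeroʳ (pow p m)
  pqBinom-suc-sum (suc a) m = begin
    pow p m * (pow p (a ∸ m) * pqBinom a m + pow q (suc m) * pqBinom a (suc m))
      ≡⟨ *-distribˡ-+ (pow p m) _ _ ⟩
    pow p m * (pow p (a ∸ m) * pqBinom a m) + pow p m * (pow q (suc m) * pqBinom a (suc m))
      ≡⟨ cong₂ _+_ (pow-∸-pqBinom a m) (x*[y*z]≡y*[x*z] (pow p m) (pow q (suc m)) (pqBinom a (suc m))) ⟩
    pow p a * pqBinom a m + pow q (suc m) * (pow p m * pqBinom a (suc m))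
      ≡⟨ cong₂ _+_ (sym (*-identityˡ (pow p a * pqBinom a m))) (cong (pow q (suc m) *_) (pqBinom-suc-sum a m)) ⟩
    1ℚ * (pow p a * pqBinom a m) + pow q (suc m) * Σ< a term
      ≡⟨ cong (1ℚ * (pow p a * pqBinom a m) +_) (trans (Σ<-*ˡ a (pow q (suc m)) term) (Σ<-cong′ a absorb-q)) ⟩
    1ℚ * (pow p a * pqBinom a m) + Σ< a (λ j → pow q (suc j ℕ.* suc m) * (pow p (a ∸ suc j) * pqBinom (a ∸ suc j) m))
      ≡⟨ sym (Σ<-head a (λ j → pow q (j ℕ.* suc m) * (pow p (suc a ∸ suc j) * pqBinom (suc a ∸ suc j) m))) ⟩
    Σ< (suc a) (λ j → pow q (j ℕ.* suc m) * (pow p (suc a ∸ suc j) * pqBinom (suc a ∸ suc j) m)) ∎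
    where
    open ≡-Reasoning
    term : ℕ → ℚ
    term j = pow q (j ℕ.* suc m) * (pow p (a ∸ suc j) * pqBinom (a ∸ suc j) m)
    absorb-q : ∀ j → pow q (suc m) * term j ≡ pow q (suc j ℕ.* suc m) * (pow p (a ∸ suc j) * pqBinom (a ∸ suc j) m)
    absorb-q j = trans (sym (*-assoc (pow q (suc m)) _ _)) (cong (_* (pow p (a ∸ suc j) * pqBinom (a ∸ suc j) m)) (sym (pow-+ q (suc m) (j ℕ.* suc m))))

rBinom : ℚ → ℕ → ℕ → ℚ
rBinom r = pqBinom 1ℚ r

rInt≡pqInt : ∀ r n → rInt r n ≡ pqInt 1ℚ r n
rInt≡pqInt r n = Σ<-cong′ n (λ i → sym (pow-1-* (n ∸ 1 ∸ i) (pow r i)))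

rFact≡pqFact : ∀ r n → rFact r n ≡ pqFact 1ℚ r n
rFact≡pqFact r zero    = refl
rFact≡pqFact r (suc n) = cong₂ _*_ (rInt≡pqInt r (suc n)) (rFact≡pqFact r n)

rBinom-suc-sum : ∀ r a m → rBinom r a (suc m) ≡ Σ< a (λ j → pow r (j ℕ.* suc m) * rBinom r (a ∸ suc j) m)
rBinom-suc-sum r a m =
  trans (sym (pow-1-* m _))
        (trans (pqBinom-suc-sum 1ℚ r a m) (Σ<-cong′ a (λ j → cong (pow r (j ℕ.* suc m) *_) (pow-1-* (a ∸ suc j) (rBinom r (a ∸ suc j) m)))))

-- Coloured codes

module CodeSum (k : ℕ) (p q r x : ℚ) where

  -- A first letter of rank i among the n + 1 unused letters is followed by i smaller and n − i
  -- larger letters.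
  codeWeight : ℕ → ℕ → ℕ → ℚ
  codeWeight n i c = pow q i * pow p (n ∸ i) * pow r c

  -- The rank i₀ of the previous letter is taken among the letters unused after it, so the previous
  -- letter is smaller than the current one iff i₀ ≤ i (see <ᵇ-rank).
  ascent : Maybe (ℕ × ℕ) → ℕ → ℕ → Bool
  ascent nothing          i c = false
  ascent (just (i₀ , c₀)) i c = (i₀ ≤ᵇ i) ∧ (c₀ <ᵇ c)

  codeSum : ℕ → Maybe (ℕ × ℕ) → ℚ
  codeSum zero    prev = 1ℚ
  codeSum (suc n) prev = Σ<² (suc n) k (λ i c →
    pow x (if ascent prev i c then 1 else 0) * (codeWeight n i c * codeSum n (just (i , c))))

  codeSumFrom : ℕ → ℕ → ℕ → ℚ
  codeSumFrom n i c = codeSum n (just (i , c))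

  prepend : ℕ → ℕ → ℕ → (ℕ → ℕ → ℚ) → ℚ
  prepend N i₀ c₀ f = Σ<² (suc N) k (λ i c → indicator ((i₀ ≤ᵇ i) ∧ (c₀ ≤ᵇ c)) * (codeWeight N i c * f i c))

  module _ (N i₀ c₀ : ℕ) where

    private
      coeff : ℕ → ℕ → ℚ
      coeff i c = indicator ((i₀ ≤ᵇ i) ∧ (c₀ ≤ᵇ c))

    prepend-cong : ∀ {f g : ℕ → ℕ → ℚ} → (∀ i c → f i c ≡ g i c) → prepend N i₀ c₀ f ≡ prepend N i₀ c₀ g
    prepend-cong f≗g = Σ<²-cong (suc N) k (λ i c → cong (λ z → coeff i c * (codeWeight N i c * z)) (f≗g i c))

    prepend-distrib-+ : ∀ (f g : ℕ → ℕ → ℚ) →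
      prepend N i₀ c₀ (λ i c → f i c + g i c) ≡ prepend N i₀ c₀ f + prepend N i₀ c₀ g
    prepend-distrib-+ f g = trans (Σ<²-cong (suc N) k (λ i c → distrib (coeff i c) (codeWeight N i c) (f i c) (g i c)))
                                  (Σ<²-distrib-+ (suc N) k _ _)
      where
      distrib : ∀ a w u v → a * (w * (u + v)) ≡ a * (w * u) + a * (w * v)
      distrib = solve-∀ ℚ-ring

    prepend-*ˡ : ∀ a (f : ℕ → ℕ → ℚ) → prepend N i₀ c₀ (λ i c → a * f i c) ≡ a * prepend N i₀ c₀ f
    prepend-*ˡ a f = trans (Σ<²-cong (suc N) k (λ i c → pull a (coeff i c) (codeWeight N i c) (f i c)))
                           (sym (Σ<²-*ˡ (suc N) k a _))
      where
      pull : ∀ a e w u → e * (w * (a * u)) ≡ a * (e * (w * u))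
      pull = solve-∀ ℚ-ring

    prepend-*ʳ : ∀ (f : ℕ → ℕ → ℚ) a → prepend N i₀ c₀ (λ i c → f i c * a) ≡ prepend N i₀ c₀ f * a
    prepend-*ʳ f a = trans (prepend-cong (λ i c → *-comm (f i c) a)) (trans (prepend-*ˡ a f) (*-comm a _))

    prepend-Σ< : ∀ l (f : ℕ → ℕ → ℕ → ℚ) →
      prepend N i₀ c₀ (λ i c → Σ< l (f i c)) ≡ Σ< l (λ t → prepend N i₀ c₀ (λ i c → f i c t))
    prepend-Σ< l f = trans (Σ<²-cong (suc N) k inside) (Σ<²-comm-Σ< (suc N) k l _)
      where
      inside : ∀ i c → coeff i c * (codeWeight N i c * Σ< l (f i c)) ≡ Σ< l (λ t → coeff i c * (codeWeight N i c * f i c t))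
      inside i c = trans (cong (coeff i c *_) (Σ<-*ˡ l (codeWeight N i c) (f i c))) (Σ<-*ˡ l (coeff i c) _)

    prepend-separate : ∀ (f g : ℕ → ℚ) → prepend N i₀ c₀ (λ i c → f i * g c)
      ≡ Σ< (suc N) (λ i → indicator (i₀ ≤ᵇ i) * (pow q i * pow p (N ∸ i) * f i))
        * Σ< k (λ c → indicator (c₀ ≤ᵇ c) * (pow r c * g c))
    prepend-separate f g = trans (Σ<²-cong (suc N) k split) (Σ<-product (suc N) k _ _)
      where
      regroup : ∀ a b u v w s t → a * b * (u * v * w * (s * t)) ≡ a * (u * v * s) * (b * (w * t))
      regroup = solve-∀ ℚ-ring
      split : ∀ i c → coeff i c * (codeWeight N i c * (f i * g c))
                    ≡ indicator (i₀ ≤ᵇ i) * (pow q i * pow p (N ∸ i) * f i) * (indicator (c₀ ≤ᵇ c) * (pow r c * g c))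
      split i c = trans (cong (_* (codeWeight N i c * (f i * g c))) (indicator-∧ (i₀ ≤ᵇ i) (c₀ ≤ᵇ c)))
                        (regroup (indicator (i₀ ≤ᵇ i)) (indicator (c₀ ≤ᵇ c)) (pow q i) (pow p (N ∸ i)) (pow r c) (f i) (g c))

  pow-ascent : ∀ b → pow x (if b then 1 else 0) ≡ 1ℚ + (x - 1ℚ) * indicator b
  pow-ascent true  = identity x
    where
    identity : ∀ x → x * 1ℚ ≡ 1ℚ + (x - 1ℚ) * 1ℚ
    identity = solve-∀ ℚ-ring
  pow-ascent false = identity x
    where
    identity : ∀ x → 1ℚ ≡ 1ℚ + (x - 1ℚ) * 0ℚ
    identity = solve-∀ ℚ-ring

  codeSum-ascent : ∀ N i₀ c₀ →
    codeSum (suc N) (just (i₀ , c₀)) ≡ codeSum (suc N) nothing + (x - 1ℚ) * prepend N i₀ (suc c₀) (codeSumFrom N)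
  codeSum-ascent N i₀ c₀ =
    trans (Σ<²-cong (suc N) k split)
          (trans (Σ<²-distrib-+ (suc N) k _ _)
                 (cong (codeSum (suc N) nothing +_) (prepend-*ˡ N i₀ (suc c₀) (x - 1ℚ) (codeSumFrom N))))
    where
    distrib : ∀ x e w f → (1ℚ + (x - 1ℚ) * e) * (w * f) ≡ 1ℚ * (w * f) + e * (w * ((x - 1ℚ) * f))
    distrib = solve-∀ ℚ-ring
    split : ∀ i c → pow x (if ascent (just (i₀ , c₀)) i c then 1 else 0) * (codeWeight N i c * codeSumFrom N i c)
                  ≡ 1ℚ * (codeWeight N i c * codeSumFrom N i c)
                    + indicator ((i₀ ≤ᵇ i) ∧ (suc c₀ ≤ᵇ c)) * (codeWeight N i c * ((x - 1ℚ) * codeSumFrom N i c))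
    split i c = trans (cong (_* (codeWeight N i c * codeSumFrom N i c)) (pow-ascent (ascent (just (i₀ , c₀)) i c)))
                      (distrib x _ (codeWeight N i c) (codeSumFrom N i c))

  chainSum : ℕ → ℕ → ℕ → ℕ → ℚ
  chainSum zero    N       i₀ c₀ = codeSum N nothing
  chainSum (suc m) zero    i₀ c₀ = 0ℚ
  chainSum (suc m) (suc N) i₀ c₀ = prepend N i₀ c₀ (λ i c → chainSum m N i (suc c))

  prepend-codeSumFrom : ∀ N i₀ c₀ →
    prepend N i₀ c₀ (codeSumFrom N) ≡ Σ< (suc N) (λ m → pow (x - 1ℚ) m * chainSum (suc m) (suc N) i₀ c₀)
  prepend-codeSumFrom zero    i₀ c₀ = sym (trans (+-identityˡ _) (*-identityˡ _))
  prepend-codeSumFrom (suc N) i₀ c₀ = begin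
    prepend (suc N) i₀ c₀ (codeSumFrom (suc N))
      ≡⟨ prepend-cong (suc N) i₀ c₀ expand ⟩
    prepend (suc N) i₀ c₀ (λ i c → codeSum (suc N) nothing + Σ< (suc N) (λ m → pow (x - 1ℚ) (suc m) * chainSum (suc m) (suc N) i (suc c)))
      ≡⟨ prepend-distrib-+ (suc N) i₀ c₀ _ _ ⟩
    chainSum 1 (suc (suc N)) i₀ c₀ + prepend (suc N) i₀ c₀ (λ i c → Σ< (suc N) (λ m → pow (x - 1ℚ) (suc m) * chainSum (suc m) (suc N) i (suc c)))
      ≡⟨ cong₂ _+_ (sym (*-identityˡ (chainSum 1 (suc (suc N)) i₀ c₀))) (trans (prepend-Σ< (suc N) i₀ c₀ (suc N) _)
                                               (Σ<-cong′ (suc N) (λ m → prepend-*ˡ (suc N) i₀ c₀ (pow (x - 1ℚ) (suc m))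
                                                                           (λ i c → chainSum (suc m) (suc N) i (suc c))))) ⟩
    1ℚ * chainSum 1 (suc (suc N)) i₀ c₀ + Σ< (suc N) (λ m → pow (x - 1ℚ) (suc m) * chainSum (suc (suc m)) (suc (suc N)) i₀ c₀)
      ≡⟨ sym (Σ<-head (suc N) (λ m → pow (x - 1ℚ) m * chainSum (suc m) (suc (suc N)) i₀ c₀)) ⟩
    Σ< (suc (suc N)) (λ m → pow (x - 1ℚ) m * chainSum (suc m) (suc (suc N)) i₀ c₀) ∎
    where
    open ≡-Reasoning
    expand : ∀ i c → codeSumFrom (suc N) i c
                   ≡ codeSum (suc N) nothing + Σ< (suc N) (λ m → pow (x - 1ℚ) (suc m) * chainSum (suc m) (suc N) i (suc c))
    expand i c = trans (codeSum-ascent N i c) (cong (codeSum (suc N) nothing +_) (begin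
      (x - 1ℚ) * prepend N i (suc c) (codeSumFrom N)
        ≡⟨ cong ((x - 1ℚ) *_) (prepend-codeSumFrom N i (suc c)) ⟩
      (x - 1ℚ) * Σ< (suc N) (λ m → pow (x - 1ℚ) m * chainSum (suc m) (suc N) i (suc c))
        ≡⟨ Σ<-*ˡ (suc N) (x - 1ℚ) _ ⟩
      Σ< (suc N) (λ m → (x - 1ℚ) * (pow (x - 1ℚ) m * chainSum (suc m) (suc N) i (suc c)))
        ≡⟨ Σ<-cong′ (suc N) (λ m → sym (*-assoc (x - 1ℚ) _ _)) ⟩
      Σ< (suc N) (λ m → pow (x - 1ℚ) (suc m) * chainSum (suc m) (suc N) i (suc c)) ∎))

  rankChain : ℕ → ℕ → ℕ → ℚ
  rankChain zero    N       i₀ = 1ℚ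
  rankChain (suc m) zero    i₀ = 0ℚ
  rankChain (suc m) (suc N) i₀ = Σ< (suc N) (λ i → indicator (i₀ ≤ᵇ i) * (pow q i * pow p (N ∸ i) * rankChain m N i))

  colourChain : ℕ → ℕ → ℚ
  colourChain zero    c₀ = 1ℚ
  colourChain (suc m) c₀ = Σ< k (λ c → indicator (c₀ ≤ᵇ c) * (pow r c * colourChain m (suc c)))

  chainSum-factor : ∀ m N i₀ c₀ → chainSum m N i₀ c₀ ≡ rankChain m N i₀ * colourChain m c₀ * codeSum (N ∸ m) nothing
  chainSum-factor zero    N       i₀ c₀ = sym (*-identityˡ _)
  chainSum-factor (suc m) zero    i₀ c₀ = sym (trans (cong (_* 1ℚ) (*-zeroˡ (colourChain (suc m) c₀))) (*-zeroˡ 1ℚ))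
  chainSum-factor (suc m) (suc N) i₀ c₀ =
    trans (prepend-cong N i₀ c₀ (λ i c → chainSum-factor m N i (suc c)))
          (trans (prepend-*ʳ N i₀ c₀ _ _) (cong (_* codeSum (N ∸ m) nothing) (prepend-separate N i₀ c₀ _ _)))

  rankChain-closed : ∀ m N i₀ → rankChain m N i₀ ≡ pow q (i₀ ℕ.* m) * pow p (m C 2) * pqBinom p q (N ∸ i₀) m
  rankChain-closed zero    N       i₀ rewrite ℕₚ.*-zeroʳ i₀ = refl
  rankChain-closed (suc m) zero    i₀ rewrite ℕₚ.0∸n≡0 i₀ = sym (*-zeroʳ (pow q (i₀ ℕ.* suc m) * pow p (suc m C 2)))
  rankChain-closed (suc m) (suc N) i₀ = begin
    Σ< (suc N) (λ i → indicator (i₀ ≤ᵇ i) * (pow q i * pow p (N ∸ i) * rankChain m N i))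
      ≡⟨ Σ<-from (suc N) i₀ _ ⟩
    Σ< a (λ j → pow q (i₀ ℕ.+ j) * pow p (N ∸ (i₀ ℕ.+ j)) * rankChain m N (i₀ ℕ.+ j))
      ≡⟨ Σ<-cong′ a term ⟩
    Σ< a (λ j → coeff * (pow q (j ℕ.* suc m) * (pow p (a ∸ suc j) * pqBinom p q (a ∸ suc j) m)))
      ≡⟨ sym (Σ<-*ˡ a coeff _) ⟩
    coeff * Σ< a (λ j → pow q (j ℕ.* suc m) * (pow p (a ∸ suc j) * pqBinom p q (a ∸ suc j) m))
      ≡⟨ cong (coeff *_) (sym (pqBinom-suc-sum p q a m)) ⟩
    coeff * (pow p m * pqBinom p q a (suc m))
      ≡⟨ *-assoc-swap (pow q (i₀ ℕ.* suc m)) (pow p (m C 2)) (pow p m) _ ⟩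
    pow q (i₀ ℕ.* suc m) * (pow p m * pow p (m C 2)) * pqBinom p q a (suc m)
      ≡⟨ cong (λ z → pow q (i₀ ℕ.* suc m) * z * pqBinom p q a (suc m))
              (trans (sym (pow-+ p m (m C 2))) (cong (pow p) (sym (suc-C2 m)))) ⟩
    pow q (i₀ ℕ.* suc m) * pow p (suc m C 2) * pqBinom p q a (suc m) ∎
    where
    open ≡-Reasoning
    a : ℕ
    a = suc N ∸ i₀
    coeff : ℚ
    coeff = pow q (i₀ ℕ.* suc m) * pow p (m C 2)
    *-assoc-swap : ∀ u v w g → u * v * (w * g) ≡ u * (w * v) * g
    *-assoc-swap = solve-∀ ℚ-ring
    exponent : ∀ i j m → i ℕ.+ j ℕ.+ (i ℕ.+ j) ℕ.* m ≡ i ℕ.* suc m ℕ.+ j ℕ.* suc m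
    exponent = ℕ-solve-∀
    N∸ : ∀ j → N ∸ (i₀ ℕ.+ j) ≡ a ∸ suc j
    N∸ j = ∸-suc-+ (suc N) i₀ j
    regroup₁ : ∀ u v w y g → u * v * (w * y * g) ≡ (u * w) * y * (v * g)
    regroup₁ = solve-∀ ℚ-ring
    regroup₂ : ∀ u v y h → u * v * y * h ≡ u * y * (v * h)
    regroup₂ = solve-∀ ℚ-ring
    term : ∀ j → pow q (i₀ ℕ.+ j) * pow p (N ∸ (i₀ ℕ.+ j)) * rankChain m N (i₀ ℕ.+ j)
               ≡ coeff * (pow q (j ℕ.* suc m) * (pow p (a ∸ suc j) * pqBinom p q (a ∸ suc j) m))
    term j rewrite rankChain-closed m N (i₀ ℕ.+ j) | N∸ j =
      trans (regroup₁ (pow q (i₀ ℕ.+ j)) (pow p (a ∸ suc j)) (pow q ((i₀ ℕ.+ j) ℕ.* m)) (pow p (m C 2)) _)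
            (trans (cong (λ z → z * pow p (m C 2) * (pow p (a ∸ suc j) * pqBinom p q (a ∸ suc j) m))
                         (pow-*-pow q (i₀ ℕ.+ j) ((i₀ ℕ.+ j) ℕ.* m) (i₀ ℕ.* suc m) (j ℕ.* suc m) (exponent i₀ j m)))
                   (regroup₂ (pow q (i₀ ℕ.* suc m)) (pow q (j ℕ.* suc m)) (pow p (m C 2)) _))

  colourChain-closed : ∀ m s → colourChain m s ≡ pow r (s ℕ.* m ℕ.+ m C 2) * rBinom r (k ∸ s) m
  colourChain-closed zero    s rewrite ℕₚ.*-zeroʳ s = refl
  colourChain-closed (suc m) s = begin
    Σ< k (λ c → indicator (s ≤ᵇ c) * (pow r c * colourChain m (suc c)))
      ≡⟨ Σ<-from k s _ ⟩
    Σ< a (λ j → pow r (s ℕ.+ j) * colourChain m (suc (s ℕ.+ j)))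
      ≡⟨ Σ<-cong′ a term ⟩
    Σ< a (λ j → pow r e * (pow r (j ℕ.* suc m) * rBinom r (a ∸ suc j) m))
      ≡⟨ sym (Σ<-*ˡ a (pow r e) _) ⟩
    pow r e * Σ< a (λ j → pow r (j ℕ.* suc m) * rBinom r (a ∸ suc j) m)
      ≡⟨ cong (pow r e *_) (sym (rBinom-suc-sum r a m)) ⟩
    pow r e * rBinom r a (suc m) ∎
    where
    open ≡-Reasoning
    a e : ℕ
    a = k ∸ s
    e = s ℕ.* suc m ℕ.+ suc m C 2
    exponent : ∀ s j m c → s ℕ.+ j ℕ.+ (suc (s ℕ.+ j) ℕ.* m ℕ.+ c) ≡ s ℕ.* suc m ℕ.+ (m ℕ.+ c) ℕ.+ j ℕ.* suc m
    exponent = ℕ-solve-∀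
    k∸ : ∀ j → k ∸ suc (s ℕ.+ j) ≡ a ∸ suc j
    k∸ = ∸-suc-+ k s
    term : ∀ j → pow r (s ℕ.+ j) * colourChain m (suc (s ℕ.+ j)) ≡ pow r e * (pow r (j ℕ.* suc m) * rBinom r (a ∸ suc j) m)
    term j rewrite colourChain-closed m (suc (s ℕ.+ j)) | k∸ j =
      trans (sym (*-assoc (pow r (s ℕ.+ j)) _ _))
            (trans (cong (_* rBinom r (a ∸ suc j) m)
                         (pow-*-pow r (s ℕ.+ j) (suc (s ℕ.+ j) ℕ.* m ℕ.+ m C 2) e (j ℕ.* suc m)
                                    (trans (exponent s j m (m C 2)) (cong (λ c → s ℕ.* suc m ℕ.+ c ℕ.+ j ℕ.* suc m) (sym (suc-C2 m))))))
                   (*-assoc (pow r e) _ _))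

  codeSum-recurrence : ∀ N → codeSum (suc N) nothing ≡ Σ< (suc N) (λ m →
    pow (x - 1ℚ) m * (pow p (suc m C 2) * pqBinom p q (suc N) (suc m) * (pow r (suc m C 2) * rBinom r k (suc m))
                      * codeSum (N ∸ m) nothing))
  -- With the bounds (0 , 0) every indicator is 1ℚ, so codeSum (suc N) nothing is
  -- prepend N 0 0 (codeSumFrom N) by definition.
  codeSum-recurrence N = trans (prepend-codeSumFrom N 0 0) (Σ<-cong′ (suc N) (λ m → cong (pow (x - 1ℚ) m *_)
    (trans (chainSum-factor (suc m) (suc N) 0 0)
           (cong₂ (λ u v → u * v * codeSum (N ∸ m) nothing)
                  (trans (rankChain-closed (suc m) (suc N) 0) (cong (_* pqBinom p q (suc N) (suc m)) (*-identityˡ (pow p (suc m C 2)))))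
                  (colourChain-closed (suc m) 0)))))

-- Ranks in increasing lists

remove : ℕ → List ℕ → List ℕ
remove a = filter (λ b → ¬? (a ℕ.≟ b))

rank : List ℕ → ℕ → ℕ
rank B a = count (_<ᵇ a) B

Increasing : List ℕ → Set
Increasing = AllPairs _<_

remove-head : ∀ a B → remove a (a ∷ B) ≡ remove a B
remove-head a B = Listₚ.filter-reject (λ b → ¬? (a ℕ.≟ b)) (λ a≢a → a≢a refl)

remove-cons : ∀ {a b} B → a ≢ b → remove a (b ∷ B) ≡ b ∷ remove a B
remove-cons {a} B a≢b = Listₚ.filter-accept (λ b → ¬? (a ℕ.≟ b)) a≢b

∉-remove : ∀ a B → a ∉ remove a B
∉-remove a B a∈ = proj₂ (∈-filter⁻ (λ b → ¬? (a ℕ.≟ b)) {xs = B} a∈) refl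

remove-least : ∀ {a B} → All (a <_) B → remove a (a ∷ B) ≡ B
remove-least {a} {B} a<B = trans (remove-head a B) (Listₚ.filter-all (λ b → ¬? (a ℕ.≟ b)) (All.map ℕₚ.<⇒≢ a<B))

Increasing-remove : ∀ a {B} → Increasing B → Increasing (remove a B)
Increasing-remove a = AllPairsₚ.filter⁺ (λ b → ¬? (a ℕ.≟ b))

count-cons : ∀ P b s → count P (b ∷ s) ≡ (if P b then suc (count P s) else count P s)
count-cons P b s with P b
... | true  = refl
... | false = refl

count-remove : ∀ P a B → P a ≡ false → count P (remove a B) ≡ count P B
count-remove P a []      Pa = refl
count-remove P a (b ∷ B) Pa with a ℕ.≟ b
... | yes refl = trans (cong (count P) (remove-head a B))
                       (trans (count-remove P a B Pa) (sym (trans (count-cons P a B) (cong (λ t → if t then suc (count P B) else count P B) Pa))))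
... | no  a≢b  = trans (cong (count P) (remove-cons B a≢b))
                       (trans (count-cons P b (remove a B))
                              (trans (cong (λ z → if P b then suc z else z) (count-remove P a B Pa)) (sym (count-cons P b B))))

rank-remove : ∀ a B → rank (remove a B) a ≡ rank B a
rank-remove a B = count-remove (_<ᵇ a) a B (<ᵇ-false (ℕₚ.n≮n a))

count-<-+-count-> : ∀ a u → a ∉ u → count (_<ᵇ a) u ℕ.+ count (a <ᵇ_) u ≡ length u
count-<-+-count-> a []      a∉u = refl
count-<-+-count-> a (b ∷ u) a∉u with ℕₚ.<-cmp b a
... | tri< b<a _ _ rewrite <ᵇ-true b<a | <ᵇ-false (ℕₚ.<⇒≯ b<a) =
  cong suc (count-<-+-count-> a u (a∉u ∘ there))
... | tri≈ _ refl _ = ⊥-elim (a∉u (here refl))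
... | tri> _ _ a<b rewrite <ᵇ-false (ℕₚ.<⇒≯ a<b) | <ᵇ-true a<b =
  trans (ℕₚ.+-suc _ _) (cong suc (count-<-+-count-> a u (a∉u ∘ there)))

length-remove : ∀ {a B} → Increasing B → a ∈ B → suc (length (remove a B)) ≡ length B
length-remove {a} {b ∷ B} (b<B ∷ _) (here refl) = cong (suc ∘ length) (remove-least b<B)
length-remove {a} {b ∷ B} (b<B ∷ incB) (there a∈B) =
  trans (cong (suc ∘ length) (remove-cons B (ℕₚ.>⇒≢ (All.lookup b<B a∈B)))) (cong suc (length-remove incB a∈B))

rank-mono : ∀ {a b} B → a ≤ b → rank B a ≤ rank B b
rank-mono             []      a≤b = z≤n
rank-mono {a} {b} (y ∷ B) a≤b rewrite count-cons (_<ᵇ a) y B | count-cons (_<ᵇ b) y B with y ℕ.<? a | y ℕ.<? b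
... | yes y<a | _       rewrite <ᵇ-true y<a | <ᵇ-true (ℕₚ.<-≤-trans y<a a≤b) = s≤s (rank-mono B a≤b)
... | no  y≮a | yes y<b rewrite <ᵇ-false y≮a | <ᵇ-true y<b = ℕₚ.m≤n⇒m≤1+n (rank-mono B a≤b)
... | no  y≮a | no  y≮b rewrite <ᵇ-false y≮a | <ᵇ-false y≮b = rank-mono B a≤b

rank-strict : ∀ {a b B} → a ∈ B → a < b → rank B a < rank B b
rank-strict {a} {b} {y ∷ B} (here refl) a<b rewrite <ᵇ-false (ℕₚ.n≮n a) | <ᵇ-true a<b =
  s≤s (rank-mono B (ℕₚ.<⇒≤ a<b))
rank-strict {a} {b} {y ∷ B} (there a∈B) a<b rewrite count-cons (_<ᵇ a) y B | count-cons (_<ᵇ b) y B with y ℕ.<? a | y ℕ.<? b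
... | yes y<a | _       rewrite <ᵇ-true y<a | <ᵇ-true (ℕₚ.<-trans y<a a<b) = s≤s (rank-strict a∈B a<b)
... | no  y≮a | yes y<b rewrite <ᵇ-false y≮a | <ᵇ-true y<b = ℕₚ.m≤n⇒m≤1+n (rank-strict a∈B a<b)
... | no  y≮a | no  y≮b rewrite <ᵇ-false y≮a | <ᵇ-false y≮b = rank-strict a∈B a<b

<ᵇ-rank : ∀ {a₀ a B} → a ∈ B → a₀ ∉ B → (a₀ <ᵇ a) ≡ (rank B a₀ ≤ᵇ rank B a)
<ᵇ-rank {a₀} {a} {B} a∈B a₀∉B with ℕₚ.<-cmp a₀ a
... | tri< a₀<a _ _   = trans (<ᵇ-true a₀<a) (sym (≤ᵇ-true (rank-mono B (ℕₚ.<⇒≤ a₀<a))))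
... | tri≈ _ refl _   = ⊥-elim (a₀∉B a∈B)
... | tri> a₀≮a _ a<a₀ = trans (<ᵇ-false a₀≮a) (sym (≤ᵇ-false (ℕₚ.<⇒≱ (rank-strict a∈B a<a₀))))

rank-least : ∀ {b} B → All (b <_) B → rank B b ≡ 0
rank-least []      []          = refl
rank-least (y ∷ B) (b<y ∷ b<B) rewrite <ᵇ-false (ℕₚ.<⇒≯ b<y) = rank-least B b<B

sumL-rank : ∀ (f : ℕ → ℚ) {B} → Increasing B → sumL (f ∘ rank B) B ≡ Σ< (length B) f
sumL-rank f {[]}    []            = refl
sumL-rank f {b ∷ B} (b<B ∷ incB) = trans (cong₂ _+_ least rest) (sym (Σ<-head (length B) f))
  where
  least : f (rank (b ∷ B) b) ≡ f 0
  least rewrite <ᵇ-false (ℕₚ.n≮n b) = cong f (rank-least B b<B)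
  shift : ∀ {a} → b < a → f (rank (b ∷ B) a) ≡ f (suc (rank B a))
  shift b<a rewrite <ᵇ-true b<a = refl
  rest : sumL (f ∘ rank (b ∷ B)) B ≡ Σ< (length B) (f ∘ suc)
  rest = trans (sumL-cong-All B (All.map shift b<B)) (sumL-rank (f ∘ suc) incB)

prodL : (ℕ → ℚ) → List ℕ → ℚ
prodL h []      = 1ℚ
prodL h (a ∷ u) = h a * prodL h u

prodL-one : ∀ σ → prodL (λ _ → 1ℚ) σ ≡ 1ℚ
prodL-one []      = refl
prodL-one (a ∷ σ) = trans (*-identityˡ _) (prodL-one σ)

prodL-remove : ∀ h {a B} → Increasing B → a ∈ B → h a * prodL h (remove a B) ≡ prodL h B
prodL-remove h {a} {b ∷ B} (b<B ∷ _) (here refl) rewrite remove-least b<B = refl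
prodL-remove h {a} {b ∷ B} (b<B ∷ incB) (there a∈B)
  rewrite remove-cons B (ℕₚ.>⇒≢ (All.lookup b<B a∈B)) =
  trans (x*[y*z]≡y*[x*z] (h a) (h b) _) (cong (h b *_) (prodL-remove h incB a∈B))

-- Coloured words

sumL-words-suc : ∀ (f : List ℕ → ℚ) A n → sumL f (words A (suc n)) ≡ sumL (λ a → sumL (f ∘ (a ∷_)) (words A n)) A
sumL-words-suc f A n = trans (sumL-concatMap f (λ a → map (a ∷_) (words A n)) A)
                             (sumL-cong (λ a → sumL-map f (a ∷_) (words A n)) A)

-- Chosen so that does (unique? (a ∷ u)) reduces to fresh a u ∧ does (unique? u).
fresh : ℕ → List ℕ → Bool
fresh a u = does (all? (λ b → ¬? (a ℕ.≟ b)) u)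

sumL-words-fresh : ∀ a B n (g : List ℕ → ℚ) →
  sumL (λ u → if fresh a u then g u else 0ℚ) (words B n) ≡ sumL g (words (remove a B) n)
sumL-words-fresh a B zero    g = refl
sumL-words-fresh a B (suc n) g = begin
  sumL (λ u → if fresh a u then g u else 0ℚ) (words B (suc n))
    ≡⟨ sumL-words-suc _ B n ⟩
  sumL (λ b → sumL (λ u → if does (¬? (a ℕ.≟ b)) ∧ fresh a u then g (b ∷ u) else 0ℚ) (words B n)) B
    ≡⟨ sumL-cong (λ b → sumL-guard (does (¬? (a ℕ.≟ b))) (g ∘ (b ∷_))) B ⟩
  sumL (λ b → if does (¬? (a ℕ.≟ b)) then sumL (λ u → if fresh a u then g (b ∷ u) else 0ℚ) (words B n) else 0ℚ) B
    ≡⟨ sym (sumL-filter (λ b → ¬? (a ℕ.≟ b)) _ B) ⟩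
  sumL (λ b → sumL (λ u → if fresh a u then g (b ∷ u) else 0ℚ) (words B n)) (remove a B)
    ≡⟨ sumL-cong (λ b → sumL-words-fresh a B n (g ∘ (b ∷_))) (remove a B) ⟩
  sumL (λ b → sumL (g ∘ (b ∷_)) (words (remove a B) n)) (remove a B)
    ≡⟨ sym (sumL-words-suc g (remove a B) n) ⟩
  sumL g (words (remove a B) (suc n)) ∎
  where
  open ≡-Reasoning
  sumL-guard : ∀ t (f : List ℕ → ℚ) → sumL (λ u → if t ∧ fresh a u then f u else 0ℚ) (words B n)
                                      ≡ (if t then sumL (λ u → if fresh a u then f u else 0ℚ) (words B n) else 0ℚ)
  sumL-guard true  f = refl
  sumL-guard false f = sumL-zero (words B n)

module Enumeration (k : ℕ) (p q r x : ℚ) where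

  open CodeSum k p q r x

  -- The inversions and coinversions of a first letter a with the later letters are charged to
  -- those later letters.
  absorb : (ℕ → ℚ) → ℕ → ℕ → ℚ
  absorb h a b = h b * (if b <ᵇ a then q else if a <ᵇ b then p else 1ℚ)

  wordAscent : Maybe (ℕ × ℕ) → ℕ → ℕ → Bool
  wordAscent nothing          a c = false
  wordAscent (just (a₀ , c₀)) a c = (a₀ <ᵇ a) ∧ (c₀ <ᵇ c)

  srisAfter : Maybe (ℕ × ℕ) → List (ℕ × ℕ) → ℕ
  srisAfter nothing   l = srisL l
  srisAfter (just ac) l = srisL (ac ∷ l)

  weight : Maybe (ℕ × ℕ) → List ℕ → List ℕ → ℚ
  weight prev σ w = pow q (inv σ) * pow p (coinv σ) * pow r (norm w) * pow x (srisAfter prev (zip σ w))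

  firstLetter : (ℕ → ℚ) → Maybe (ℕ × ℕ) → ℕ → ℕ → ℚ
  firstLetter h prev a c = h a * pow x (if wordAscent prev a c then 1 else 0) * pow r c

  colouredSum : ℕ → (ℕ → ℚ) → Maybe (ℕ × ℕ) → List ℕ → ℚ
  colouredSum n h prev σ = sumL (λ w → prodL h σ * weight prev σ w) (colours k n)

  wordSum : ℕ → List ℕ → (ℕ → ℚ) → Maybe (ℕ × ℕ) → ℚ
  wordSum n B h prev = sumL (λ σ → if does (unique? σ) then colouredSum n h prev σ else 0ℚ) (words B n)

  prodL-absorb : ∀ h a u → prodL (absorb h a) u ≡ prodL h u * (pow q (count (_<ᵇ a) u) * pow p (count (a <ᵇ_) u))
  prodL-absorb h a []      = refl
  prodL-absorb h a (b ∷ u) with ℕₚ.<-cmp b a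
  ... | tri< b<a _ _ rewrite <ᵇ-true b<a | <ᵇ-false (ℕₚ.<⇒≯ b<a) | prodL-absorb h a u =
    regroup (h b) q (prodL h u) (pow q (count (_<ᵇ a) u)) (pow p (count (a <ᵇ_) u))
    where
    regroup : ∀ h f P Q R → h * f * (P * (Q * R)) ≡ h * P * (f * Q * R)
    regroup = solve-∀ ℚ-ring
  ... | tri≈ _ refl _ rewrite <ᵇ-false (ℕₚ.n≮n a) | prodL-absorb h a u =
    regroup (h a) (prodL h u) (pow q (count (_<ᵇ a) u)) (pow p (count (a <ᵇ_) u))
    where
    regroup : ∀ h P Q R → h * 1ℚ * (P * (Q * R)) ≡ h * P * (Q * R)
    regroup = solve-∀ ℚ-ring
  ... | tri> _ _ a<b rewrite <ᵇ-false (ℕₚ.<⇒≯ a<b) | <ᵇ-true a<b | prodL-absorb h a u =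
    regroup (h b) p (prodL h u) (pow q (count (_<ᵇ a) u)) (pow p (count (a <ᵇ_) u))
    where
    regroup : ∀ h f P Q R → h * f * (P * (Q * R)) ≡ h * P * (Q * (f * R))
    regroup = solve-∀ ℚ-ring

  srisAfter-cons : ∀ prev a c l →
    srisAfter prev ((a , c) ∷ l) ≡ (if wordAscent prev a c then 1 else 0) ℕ.+ srisAfter (just (a , c)) l
  srisAfter-cons nothing  a c l = refl
  srisAfter-cons (just _) a c l = refl

  weight-cons : ∀ h prev a c u w → prodL h (a ∷ u) * weight prev (a ∷ u) (c ∷ w)
                                  ≡ firstLetter h prev a c * (prodL (absorb h a) u * weight (just (a , c)) u w)
  weight-cons h prev a c u w
    rewrite srisAfter-cons prev a c (zip u w)
          | pow-+ q (count (_<ᵇ a) u) (inv u)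
          | pow-+ p (count (a <ᵇ_) u) (coinv u)
          | pow-+ r c (norm w)
          | pow-+ x (if wordAscent prev a c then 1 else 0) (srisAfter (just (a , c)) (zip u w))
          | prodL-absorb h a u
    = regroup (h a) (prodL h u) (pow q (count (_<ᵇ a) u)) (pow p (count (a <ᵇ_) u)) (pow q (inv u)) (pow p (coinv u))
              (pow r c) (pow r (norm w)) (pow x (if wordAscent prev a c then 1 else 0)) (pow x (srisAfter (just (a , c)) (zip u w)))
    where
    regroup : ∀ h P Q₁ P₁ Q₂ P₂ R₁ R₂ X₁ X₂ → h * P * ((Q₁ * Q₂) * (P₁ * P₂) * (R₁ * R₂) * (X₁ * X₂))
                                            ≡ h * X₁ * R₁ * (P * (Q₁ * P₁) * (Q₂ * P₂ * R₂ * X₂))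
    regroup = solve-∀ ℚ-ring

  colouredSum-cons : ∀ n h prev a u →
    colouredSum (suc n) h prev (a ∷ u) ≡ sumL (λ c → firstLetter h prev a c * colouredSum n (absorb h a) (just (a , c)) u) (upTo k)
  colouredSum-cons n h prev a u =
    trans (sumL-words-suc _ (upTo k) n)
          (sumL-cong (λ c → trans (sumL-cong (weight-cons h prev a c u) (colours k n))
                                  (sym (sumL-*ˡ (firstLetter h prev a c) _ (colours k n)))) (upTo k))

  wordSum-suc : ∀ n B h prev → wordSum (suc n) B h prev
    ≡ sumL (λ a → sumL (λ c → firstLetter h prev a c * wordSum n (remove a B) (absorb h a) (just (a , c))) (upTo k)) B
  wordSum-suc n B h prev = begin
    wordSum (suc n) B h prev
      ≡⟨ sumL-words-suc _ B n ⟩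
    sumL (λ a → sumL (λ u → if fresh a u ∧ does (unique? u) then colouredSum (suc n) h prev (a ∷ u) else 0ℚ) (words B n)) B
      ≡⟨ sumL-cong (λ a → sumL-cong (λ u → if-∧ (fresh a u) (does (unique? u))) (words B n)) B ⟩
    sumL (λ a → sumL (λ u → if fresh a u then distinct (colouredSum (suc n) h prev (a ∷ u)) u else 0ℚ) (words B n)) B
      ≡⟨ sumL-cong (λ a → sumL-words-fresh a B n _) B ⟩
    sumL (λ a → sumL (λ u → distinct (colouredSum (suc n) h prev (a ∷ u)) u) (words (remove a B) n)) B
      ≡⟨ sumL-cong (λ a → sumL-cong (λ u → trans (cong (λ z → distinct z u) (colouredSum-cons n h prev a u))
                                                  (distinct-sumL (does (unique? u)) (firstLetter h prev a)
                                                                 (λ c → colouredSum n (absorb h a) (just (a , c)) u) (upTo k)))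
                                     (words (remove a B) n)) B ⟩
    sumL (λ a → sumL (λ u → sumL (λ c → firstLetter h prev a c * distinct (colouredSum n (absorb h a) (just (a , c)) u) u) (upTo k))
                     (words (remove a B) n)) B
      ≡⟨ sumL-cong (λ a → sumL-comm _ (words (remove a B) n) (upTo k)) B ⟩
    sumL (λ a → sumL (λ c → sumL (λ u → firstLetter h prev a c * distinct (colouredSum n (absorb h a) (just (a , c)) u) u)
                                 (words (remove a B) n)) (upTo k)) B
      ≡⟨ sumL-cong (λ a → sumL-cong (λ c → sym (sumL-*ˡ (firstLetter h prev a c) _ (words (remove a B) n))) (upTo k)) B ⟩
    sumL (λ a → sumL (λ c → firstLetter h prev a c * wordSum n (remove a B) (absorb h a) (just (a , c))) (upTo k)) B ∎
    where
    open ≡-Reasoning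
    distinct : ℚ → List ℕ → ℚ
    distinct z u = if does (unique? u) then z else 0ℚ
    if-∧ : ∀ s t {z} → (if s ∧ t then z else 0ℚ) ≡ (if s then (if t then z else 0ℚ) else 0ℚ)
    if-∧ true  t = refl
    if-∧ false t = refl
    distinct-sumL : ∀ t (f g : ℕ → ℚ) cs →
      (if t then sumL (λ c → f c * g c) cs else 0ℚ) ≡ sumL (λ c → f c * (if t then g c else 0ℚ)) cs
    distinct-sumL true  f g cs = refl
    distinct-sumL false f g cs = sym (trans (sumL-cong (λ c → *-zeroʳ (f c)) cs) (sumL-zero cs))

  rankedPrev : List ℕ → Maybe (ℕ × ℕ) → Maybe (ℕ × ℕ)
  rankedPrev B nothing          = nothing
  rankedPrev B (just (a₀ , c₀)) = just (rank B a₀ , c₀)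

  Unused : Maybe (ℕ × ℕ) → List ℕ → Set
  Unused nothing         B = ⊤
  Unused (just (a₀ , _)) B = a₀ ∉ B

  wordAscent-rank : ∀ prev {a B} c → a ∈ B → Unused prev B → wordAscent prev a c ≡ ascent (rankedPrev B prev) (rank B a) c
  wordAscent-rank nothing          c a∈B _    = refl
  wordAscent-rank (just (a₀ , c₀)) c a∈B a₀∉B = cong (_∧ (c₀ <ᵇ c)) (<ᵇ-rank a∈B a₀∉B)

  wordSum-codeSum : ∀ n B h prev → Increasing B → length B ≡ n → Unused prev B →
    wordSum n B h prev ≡ prodL h B * codeSum n (rankedPrev B prev)
  wordSum-codeSum zero    [] h nothing  _ _ _ = refl
  wordSum-codeSum zero    [] h (just _) _ _ _ = refl
  wordSum-codeSum (suc n) B  h prev incB lenB unusedB = begin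
    wordSum (suc n) B h prev
      ≡⟨ wordSum-suc n B h prev ⟩
    sumL (λ a → sumL (λ c → firstLetter h prev a c * wordSum n (remove a B) (absorb h a) (just (a , c))) (upTo k)) B
      ≡⟨ sumL-cong-All B (All.tabulate letter) ⟩
    sumL (λ a → prodL h B * row (rank B a)) B
      ≡⟨ sym (sumL-*ˡ (prodL h B) (row ∘ rank B) B) ⟩
    prodL h B * sumL (row ∘ rank B) B
      ≡⟨ cong (prodL h B *_) (trans (sumL-rank row incB) (cong (λ m → Σ< m row) lenB)) ⟩
    prodL h B * codeSum (suc n) (rankedPrev B prev) ∎
    where
    open ≡-Reasoning
    row : ℕ → ℚ
    row i = Σ< k (λ c → pow x (if ascent (rankedPrev B prev) i c then 1 else 0) * (codeWeight n i c * codeSumFrom n i c))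
    letter : ∀ {a} → a ∈ B →
      sumL (λ c → firstLetter h prev a c * wordSum n (remove a B) (absorb h a) (just (a , c))) (upTo k) ≡ prodL h B * row (rank B a)
    letter {a} a∈B = trans (sumL-applyUpTo _ id k) (trans (Σ<-cong′ k colour) (sym (Σ<-*ˡ k (prodL h B) _)))
      where
      length-rest : length (remove a B) ≡ n
      length-rest = ℕₚ.suc-injective (trans (length-remove incB a∈B) lenB)
      greater : count (a <ᵇ_) (remove a B) ≡ n ∸ rank B a
      greater = trans (sym (ℕₚ.m+n∸m≡n (count (_<ᵇ a) (remove a B)) _))
                      (cong₂ _∸_ (trans (count-<-+-count-> a (remove a B) (∉-remove a B)) length-rest) (rank-remove a B))
      regroup : ∀ h X R P Q O → h * X * R * (P * Q * O) ≡ h * P * (X * (Q * R * O))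
      regroup = solve-∀ ℚ-ring
      colour : ∀ c → firstLetter h prev a c * wordSum n (remove a B) (absorb h a) (just (a , c))
                   ≡ prodL h B * (pow x (if ascent (rankedPrev B prev) (rank B a) c then 1 else 0)
                                  * (codeWeight n (rank B a) c * codeSumFrom n (rank B a) c))
      colour c
        rewrite wordSum-codeSum n (remove a B) (absorb h a) (just (a , c)) (Increasing-remove a incB) length-rest (∉-remove a B)
              | prodL-absorb h a (remove a B)
              | greater
              | rank-remove a B
              | wordAscent-rank prev c a∈B unusedB
              | sym (prodL-remove h incB a∈B)
        = regroup (h a) (pow x (if ascent (rankedPrev B prev) (rank B a) c then 1 else 0)) (pow r c) (prodL h (remove a B))
                  (pow q (rank B a) * pow p (n ∸ rank B a)) (codeSumFrom n (rank B a) c)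

  lhsSeries-codeSum : ∀ n → lhsSeries k p q r x n ≡ div (codeSum n nothing) (pqFact p q n)
  lhsSeries-codeSum n = cong (λ z → div z (pqFact p q n)) (begin
    sumL wreathWeight (wreath k n)
      ≡⟨ sumL-concatMap wreathWeight (λ σ → map (σ ,_) (colours k n)) (perms n) ⟩
    sumL (λ σ → sumL wreathWeight (map (σ ,_) (colours k n))) (filter unique? (words letters n))
      ≡⟨ sumL-filter unique? _ (words letters n) ⟩
    sumL (λ σ → if does (unique? σ) then sumL wreathWeight (map (σ ,_) (colours k n)) else 0ℚ) (words letters n)
      ≡⟨ sumL-cong (λ σ → cong (λ z → if does (unique? σ) then z else 0ℚ) (trans (sumL-map wreathWeight (σ ,_) (colours k n))
                                                                                (sumL-cong (λ w → sym (one-* σ w)) (colours k n))))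
                   (words letters n) ⟩
    wordSum n letters (λ _ → 1ℚ) nothing
      ≡⟨ wordSum-codeSum n letters (λ _ → 1ℚ) nothing increasing length-letters tt ⟩
    prodL (λ _ → 1ℚ) letters * codeSum n nothing
      ≡⟨ trans (cong (_* codeSum n nothing) (prodL-one letters)) (*-identityˡ _) ⟩
    codeSum n nothing ∎)
    where
    open ≡-Reasoning
    wreathWeight : List ℕ × List ℕ → ℚ
    wreathWeight (σ , w) = pow q (inv σ) * pow p (coinv σ) * pow r (norm w) * pow x (sris (σ , w))
    letters : List ℕ
    letters = map suc (upTo n)
    increasing : Increasing letters
    increasing = AllPairsₚ.map⁺ (AllPairsₚ.applyUpTo⁺₁ id n (λ i<j _ → s≤s i<j))
    length-letters : length letters ≡ n
    length-letters = trans (Listₚ.length-map suc (upTo n)) (Listₚ.length-upTo n)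
    one-* : ∀ σ w → prodL (λ _ → 1ℚ) σ * weight nothing σ w ≡ wreathWeight (σ , w)
    one-* σ w = trans (cong (_* weight nothing σ w) (prodL-one σ)) (*-identityˡ _)

-- Coefficients of the product

*-≢0 : ∀ {a b} → a ≢ 0ℚ → b ≢ 0ℚ → a * b ≢ 0ℚ
*-≢0 {a} {b} a≢0 b≢0 ab≡0 = b≢0 (begin
  b                ≡⟨ sym (*-identityˡ b) ⟩
  1ℚ * b           ≡⟨ cong (_* b) (sym (*-inverseˡ a)) ⟩
  (1/ a) * a * b   ≡⟨ *-assoc (1/ a) a b ⟩
  (1/ a) * (a * b) ≡⟨ cong ((1/ a) *_) ab≡0 ⟩
  (1/ a) * 0ℚ      ≡⟨ *-zeroʳ (1/ a) ⟩
  0ℚ               ∎)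
  where
  open ≡-Reasoning
  instance _ = ≢-nonZero a≢0

recip : (a : ℚ) → a ≢ 0ℚ → ℚ
recip a a≢0 = (1/ a) {{≢-nonZero a≢0}}

*-recip : ∀ a (a≢0 : a ≢ 0ℚ) → a * recip a a≢0 ≡ 1ℚ
*-recip a a≢0 = *-inverseʳ a {{≢-nonZero a≢0}}

div-recip : ∀ a b (b≢0 : b ≢ 0ℚ) → div a b ≡ a * recip b b≢0
div-recip a b b≢0 with b ≟ 0ℚ
... | yes b≡0 = ⊥-elim (b≢0 b≡0)
... | no  _   = refl

recip-factor : ∀ g a b c (a≢0 : a ≢ 0ℚ) (b≢0 : b ≢ 0ℚ) (c≢0 : c ≢ 0ℚ) →
  g * (a * b) ≡ c → g * recip c c≢0 ≡ recip a a≢0 * recip b b≢0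
recip-factor g a b c a≢0 b≢0 c≢0 gab≡c = sym (begin
  a⁻¹ * b⁻¹                         ≡⟨ sym (*-identityʳ (a⁻¹ * b⁻¹)) ⟩
  a⁻¹ * b⁻¹ * 1ℚ                    ≡⟨ cong (a⁻¹ * b⁻¹ *_) (sym (*-recip c c≢0)) ⟩
  a⁻¹ * b⁻¹ * (c * c⁻¹)             ≡⟨ cong (λ z → a⁻¹ * b⁻¹ * (z * c⁻¹)) (sym gab≡c) ⟩
  a⁻¹ * b⁻¹ * (g * (a * b) * c⁻¹)   ≡⟨ regroup g a b a⁻¹ b⁻¹ c⁻¹ ⟩
  g * c⁻¹ * ((a * a⁻¹) * (b * b⁻¹)) ≡⟨ cong₂ (λ u v → g * c⁻¹ * (u * v)) (*-recip a a≢0) (*-recip b b≢0) ⟩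
  g * c⁻¹ * (1ℚ * 1ℚ)               ≡⟨ *-identityʳ (g * c⁻¹) ⟩
  g * c⁻¹                           ∎)
  where
  open ≡-Reasoning
  a⁻¹ b⁻¹ c⁻¹ : ℚ
  a⁻¹ = recip a a≢0
  b⁻¹ = recip b b≢0
  c⁻¹ = recip c c≢0
  regroup : ∀ g a b a′ b′ c′ → a′ * b′ * (g * (a * b) * c′) ≡ g * c′ * ((a * a′) * (b * b′))
  regroup = solve-∀ ℚ-ring

module Coefficients (k : ℕ) (p q r x : ℚ)
  (pqInt≢0 : ∀ m → 1 ≤ m → pqInt p q m ≢ 0ℚ) (rInt≢0 : ∀ m → 1 ≤ m → rInt r m ≢ 0ℚ) where

  open CodeSum k p q r x
  open Enumeration k p q r x

  pqFact≢0 : ∀ n → pqFact p q n ≢ 0ℚ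
  pqFact≢0 zero    = λ ()
  pqFact≢0 (suc n) = *-≢0 (pqInt≢0 (suc n) (s≤s z≤n)) (pqFact≢0 n)

  rFact≢0 : ∀ n → rFact r n ≢ 0ℚ
  rFact≢0 zero    = λ ()
  rFact≢0 (suc n) = *-≢0 (rInt≢0 (suc n) (s≤s z≤n)) (rFact≢0 n)

  gbin≡rBinom : ∀ s → gbin r k s ≡ rBinom r k s
  gbin≡rBinom s with k ℕ.<? s
  ... | yes k<s rewrite <ᵇ-true k<s = sym (a<m⇒pqBinom≡0 1ℚ r k s k<s)
  ... | no  k≮s rewrite <ᵇ-false k≮s = begin
    div (rFact r k) d                 ≡⟨ div-recip (rFact r k) d d≢0 ⟩
    rFact r k * recip d d≢0           ≡⟨ cong (_* recip d d≢0) (sym binom-fact) ⟩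
    rBinom r k s * d * recip d d≢0    ≡⟨ *-assoc (rBinom r k s) d _ ⟩
    rBinom r k s * (d * recip d d≢0)  ≡⟨ cong (rBinom r k s *_) (*-recip d d≢0) ⟩
    rBinom r k s * 1ℚ                 ≡⟨ *-identityʳ _ ⟩
    rBinom r k s                      ∎
    where
    open ≡-Reasoning
    d : ℚ
    d = rFact r s * rFact r (k ∸ s)
    d≢0 : d ≢ 0ℚ
    d≢0 = *-≢0 (rFact≢0 s) (rFact≢0 (k ∸ s))
    binom-fact : rBinom r k s * d ≡ rFact r k
    binom-fact = subst (λ n → rBinom r n s * d ≡ rFact r n) (ℕₚ.m+[n∸m]≡n (ℕₚ.≮⇒≥ k≮s))
      (begin
        rBinom r (s ℕ.+ (k ∸ s)) s * d
          ≡⟨ cong (rBinom r (s ℕ.+ (k ∸ s)) s *_) (cong₂ _*_ (rFact≡pqFact r s) (rFact≡pqFact r (k ∸ s))) ⟩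
        rBinom r (s ℕ.+ (k ∸ s)) s * (pqFact 1ℚ r s * pqFact 1ℚ r (k ∸ s))
          ≡⟨ pqBinom-pqFact 1ℚ r s (k ∸ s) ⟩
        pqFact 1ℚ r (s ℕ.+ (k ∸ s))
          ≡⟨ sym (rFact≡pqFact r (s ℕ.+ (k ∸ s))) ⟩
        rFact r (s ℕ.+ (k ∸ s)) ∎)

  invFact : ℕ → ℚ
  invFact n = recip (pqFact p q n) (pqFact≢0 n)

  lhs-coeff : ∀ n → lhsSeries k p q r x n ≡ codeSum n nothing * invFact n
  lhs-coeff n = trans (lhsSeries-codeSum n) (div-recip (codeSum n nothing) (pqFact p q n) (pqFact≢0 n))

  den-coeff : ∀ m → denSeries k p q r x (suc m)
    ≡ pow p (suc m C 2) * pow (x - 1ℚ) (suc m) * invFact (suc m) * pow r (suc m C 2) * rBinom r k (suc m)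
  den-coeff m = cong₂ (λ u v → u * pow r (suc m C 2) * v)
                      (div-recip (pow p (suc m C 2) * pow (x - 1ℚ) (suc m)) (pqFact p q (suc m)) (pqFact≢0 (suc m)))
                      (gbin≡rBinom (suc m))

  pqBinom-invFact : ∀ N m → m ≤ N → pqBinom p q (suc N) (suc m) * invFact (suc N) ≡ invFact (suc m) * invFact (N ∸ m)
  pqBinom-invFact N m m≤N =
    recip-factor (pqBinom p q (suc N) (suc m)) (pqFact p q (suc m)) (pqFact p q (N ∸ m)) (pqFact p q (suc N))
                 (pqFact≢0 (suc m)) (pqFact≢0 (N ∸ m)) (pqFact≢0 (suc N))
                 (subst (λ n → pqBinom p q n (suc m) * (pqFact p q (suc m) * pqFact p q (N ∸ m)) ≡ pqFact p q n)
                        (cong suc (ℕₚ.m+[n∸m]≡n m≤N)) (pqBinom-pqFact p q (suc m) (N ∸ m)))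

  coefficient-recurrence : ∀ N →
    Σ< (suc N) (λ m → lhsSeries k p q r x (N ∸ m) * denSeries k p q r x (suc m)) + lhsSeries k p q r x (suc N) * (1ℚ - x) ≡ 0ℚ
  coefficient-recurrence N = begin
    Σ< (suc N) convolved + lhsSeries k p q r x (suc N) * (1ℚ - x)
      ≡⟨ cong (Σ< (suc N) convolved +_) top ⟩
    Σ< (suc N) convolved + Σ< (suc N) recurrent
      ≡⟨ sym (Σ<-distrib-+ (suc N) convolved recurrent) ⟩
    Σ< (suc N) (λ m → convolved m + recurrent m)
      ≡⟨ Σ<-cong (suc N) (λ m m<1+N → cancel m (ℕₚ.≤-pred m<1+N)) ⟩
    Σ< (suc N) (λ _ → 0ℚ)
      ≡⟨ Σ<-zero (suc N) ⟩
    0ℚ ∎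
    where
    open ≡-Reasoning
    convolved summand recurrent : ℕ → ℚ
    convolved m = lhsSeries k p q r x (N ∸ m) * denSeries k p q r x (suc m)
    summand m = pow (x - 1ℚ) m * (pow p (suc m C 2) * pqBinom p q (suc N) (suc m) * (pow r (suc m C 2) * rBinom r k (suc m))
                                  * codeSum (N ∸ m) nothing)
    recurrent m = summand m * invFact (suc N) * (1ℚ - x)
    top : lhsSeries k p q r x (suc N) * (1ℚ - x) ≡ Σ< (suc N) recurrent
    top = begin
      lhsSeries k p q r x (suc N) * (1ℚ - x)
        ≡⟨ cong (_* (1ℚ - x)) (lhs-coeff (suc N)) ⟩
      codeSum (suc N) nothing * invFact (suc N) * (1ℚ - x)
        ≡⟨ cong (λ z → z * invFact (suc N) * (1ℚ - x)) (codeSum-recurrence N) ⟩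
      Σ< (suc N) summand * invFact (suc N) * (1ℚ - x)
        ≡⟨ cong (_* (1ℚ - x)) (Σ<-*ʳ (suc N) (invFact (suc N)) summand) ⟩
      Σ< (suc N) (λ m → summand m * invFact (suc N)) * (1ℚ - x)
        ≡⟨ Σ<-*ʳ (suc N) (1ℚ - x) _ ⟩
      Σ< (suc N) recurrent ∎
    regroup : ∀ x y P G R K A I → y * (P * G * (R * K) * A) * I * (1ℚ - x) ≡ y * P * R * K * A * (1ℚ - x) * (G * I)
    regroup = solve-∀ ℚ-ring
    vanish : ∀ x y P R K A I₁ I₂ → A * I₁ * (P * ((x - 1ℚ) * y) * I₂ * R * K) + y * P * R * K * A * (1ℚ - x) * (I₂ * I₁) ≡ 0ℚ
    vanish = solve-∀ ℚ-ring
    cancel : ∀ m → m ≤ N → convolved m + recurrent m ≡ 0ℚ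
    cancel m m≤N rewrite lhs-coeff (N ∸ m) | den-coeff m =
      trans (cong (codeSum (N ∸ m) nothing * invFact (N ∸ m) * _ +_)
                  (trans (regroup x (pow (x - 1ℚ) m) P (pqBinom p q (suc N) (suc m)) R K (codeSum (N ∸ m) nothing) (invFact (suc N)))
                         (cong (pow (x - 1ℚ) m * P * R * K * codeSum (N ∸ m) nothing * (1ℚ - x) *_) (pqBinom-invFact N m m≤N))))
            (vanish x (pow (x - 1ℚ) m) P R K (codeSum (N ∸ m) nothing) (invFact (N ∸ m)) (invFact (suc m)))
      where
      P R K : ℚ
      P = pow p (suc m C 2)
      R = pow r (suc m C 2)
      K = rBinom r k (suc m)

theorem7 : (k : ℕ) → 2 ≤ k → (p q r x : ℚ)
    → (∀ m → 1 ≤ m → pqInt p q m ≢ 0ℚ)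
    → (∀ m → 1 ≤ m → rInt r m ≢ 0ℚ)
    → x ≢ 1ℚ
    → ∀ n → (lhsSeries k p q r x ⋆ denSeries k p q r x) n ≡ numSeries x n
-- The constant coefficient of the left-hand side
-- evaluates to 1ℚ, C_k ≀ S_0 having a single element.
theorem7 k _ p q r x pqInt≢0 rInt≢0 _ zero    = trans (+-identityˡ _) (*-identityˡ (1ℚ - x))
theorem7 k _ p q r x pqInt≢0 rInt≢0 _ (suc N) = begin
  Σ< (suc N) (λ j → lhs j * den (suc N ∸ j)) + lhs (suc N) * den (N ∸ N)
    ≡⟨ cong₂ _+_ (Σ<-convolution N lhs den) (cong (λ i → lhs (suc N) * den i) (ℕₚ.n∸n≡0 N)) ⟩
  Σ< (suc N) (λ m → lhs (N ∸ m) * den (suc m)) + lhs (suc N) * (1ℚ - x)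
    ≡⟨ Coefficients.coefficient-recurrence k p q r x pqInt≢0 rInt≢0 N ⟩
  0ℚ ∎
  where
  open ≡-Reasoning
  lhs den : Series
  lhs = lhsSeries k p q r x
  den = denSeries k p q r x
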